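{- Let $M$ be a de Morgan algebra that is a perfect extension of its Boolean subalgebra $B(M)=\{x\in M\mid x\vee x^{\circ}=1\}$, let $D$ be a bounded distributive lattice, and let $A$ be a sublattice of $\mathrm{Con}(M)\times\mathrm{Con}(D)$. Then $A$ is representable if and only if: (1) $A$ is closed under arbitrary joins; (2) $A$ is down-closed in the first coordinate: $(\theta_1,\theta_2)\in A$ and $\alpha\le\theta_1$ imply $(\alpha,\theta_2)\in A$; (3) there exists a lattice $(0,1)$-homomorphism $\varphi: M\to D$ such that for every $a\in B(M)$, with $\alpha=\theta(0,a)$ the principal congruence of $M$ generated by $(0,a)$ (which equals $\theta(a^{\circ},1)$), and every $\theta_2\in\mathrm{Con}(D)$, $(\alpha,\theta_2)\in A\iff\mathrm{Con}(\varphi)(\alpha)\subseteq\theta_2$.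
   Context: An MS-algebra is an algebra $(L;\vee,\wedge,{}^{\circ},0,1)$ where $(L;\vee,\wedge,0,1)$ is a bounded distributive lattice and ${}^{\circ}$ is a unary operation with $x\le x^{\circ\circ}$, $(x\wedge y)^{\circ}=x^{\circ}\vee y^{\circ}$ and $1^{\circ}=0$; a de Morgan algebra is an MS-algebra with $x=x^{\circ\circ}$. An algebra is a perfect extension of a subalgebra $B$ if every congruence of $B$ has exactly one extension to a congruence of the algebra. For an MS-algebra $L$: $L^{\circ\circ}=\{x\mid x=x^{\circ\circ}\}$ (a de Morgan subalgebra), $D(L)=\{x\mid x^{\circ}=0\}$. $L$ is principal if there is $d_L$ with $D(L)=\{x\mid x\ge d_L\}$ and $x=x^{\circ\circ}\wedge(x\vee d_L)$ for all $x$; then $D(L)$ is a bounded distributive lattice with bounds $d_L,1$. An MS-congruence pair of a principal MS-algebra $L$ is $(\theta_1,\theta_2)\in\mathrm{Con}(L^{\circ\circ})\times\mathrm{Con}(D(L))$ (de Morgan algebra congruences, resp. lattice congruences) such that $(a,b)\in\theta_1$ implies $(a\vee d_L,b\vee d_L)\in\theta_2$; $A(L)$ is the set of these. For a homomorphism $\tau:X\to Y$ and $\theta\in\mathrm{Con}(X)$, $\mathrm{Con}(\tau)(\theta)$ is the congruence of $Y$ generated by all pairs $(\tau(x),\tau(y))$, $(x,y)\in\theta$. A subset $A\subseteq\mathrm{Con}(M)\times\mathrm{Con}(D)$ is representable if there exist a principal MS-algebra $L$, a de Morgan algebra isomorphism $\tau_1:M\to L^{\circ\circ}$ and a bounded lattice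 isomorphism $\tau_2:D\to D(L)$ such that $A=\{(\theta_1,\theta_2)\mid(\mathrm{Con}(\tau_1)(\theta_1),\mathrm{Con}(\tau_2)(\theta_2))\in A(L)\}$. -}

module Defs where

open import Level using (0ℓ)
open import Data.Unit using (⊤; tt)
open import Data.Product using (Σ; Σ-syntax; _×_; _,_; proj₁; proj₂)
open import Data.Sum using (_⊎_)
open import Function using (_∘_)
open import Function.Bundles using (_⇔_)
open import Relation.Binary.PropositionalEquality using (_≡_)
open import Relation.Binary.Structures using (IsEquivalence)
open import Algebra.Core using (Op₁; Op₂)
import Algebra.Lattice.Structures as LS

record BDLattice : Set₁ where
  infixr 6 _∨_
  infixr 7 _∧_
  field
    Carrier : Set
    _∨_ _∧_ : Op₂ Carrier
    0# 1#   : Carrier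
    isDistributiveLattice : LS.IsDistributiveLattice _≡_ _∨_ _∧_
    0-least   : ∀ x → 0# ∨ x ≡ x
    1-greatest : ∀ x → 1# ∧ x ≡ x

  _≤_ : Carrier → Carrier → Set
  x ≤ y = x ∧ y ≡ x

record MSAlgebra : Set₁ where
  field
    lattice : BDLattice
  open BDLattice lattice public
  field
    _° : Op₁ Carrier
    ≤-°° : ∀ x → x ≤ ((x °) °)
    °-∧  : ∀ x y → (x ∧ y) ° ≡ (x °) ∨ (y °)
    1°   : 1# ° ≡ 0#

record DeMorganAlgebra : Set₁ where
  field
    msAlgebra : MSAlgebra
  open MSAlgebra msAlgebra public
  field
    °° : ∀ x → (x °) ° ≡ x

record PrincipalMS : Set₁ where
  field
    msAlgebra : MSAlgebra
  open MSAlgebra msAlgebra public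
  field
    d     : Carrier
    D-char : ∀ x → (x ° ≡ 0#) ⇔ (d ≤ x)
    decomp : ∀ x → x ≡ ((x °) °) ∧ (x ∨ d)

  InL°° : Carrier → Set
  InL°° x = x ≡ (x °) °

  InD : Carrier → Set
  InD x = x ° ≡ 0#

-- Congruence generated by a relation R inside a subset S
-- (S closed under the operations: the subalgebra), lattice signature
-- and lattice-with-° signature.  Nullary operations are trivially
-- compatible.

module _ {X : Set} (_∨_ _∧_ : Op₂ X) where
  data GenLat (S : X → Set) (R : X → X → Set) : X → X → Set where
    g-base   : ∀ {a b} → R a b → GenLat S R a b
    g-refl   : ∀ {a} → S a → GenLat S R a a
    g-sym    : ∀ {a b} → GenLat S R a b → GenLat S R b a
    g-trans  : ∀ {a b c} → GenLat S R a b → GenLat S R b c → GenLat S R a c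
    g-∨-cong : ∀ {a b c e} → GenLat S R a b → GenLat S R c e → GenLat S R (a ∨ c) (b ∨ e)
    g-∧-cong : ∀ {a b c e} → GenLat S R a b → GenLat S R c e → GenLat S R (a ∧ c) (b ∧ e)

module _ {X : Set} (_∨_ _∧_ : Op₂ X) (_° : Op₁ X) where
  data GenDM (S : X → Set) (R : X → X → Set) : X → X → Set where
    g-base   : ∀ {a b} → R a b → GenDM S R a b
    g-refl   : ∀ {a} → S a → GenDM S R a a
    g-sym    : ∀ {a b} → GenDM S R a b → GenDM S R b a
    g-trans  : ∀ {a b c} → GenDM S R a b → GenDM S R b c → GenDM S R a c
    g-∨-cong : ∀ {a b c e} → GenDM S R a b → GenDM S R c e → GenDM S R (a ∨ c) (b ∨ e)
    g-∧-cong : ∀ {a b c e} → GenDM S R a b → GenDM S R c e → GenDM S R (a ∧ c) (b ∧ e)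
    g-°-cong : ∀ {a b} → GenDM S R a b → GenDM S R (a °) (b °)

record LatCong (L : BDLattice) : Set₁ where
  open BDLattice L
  field
    rel     : Carrier → Carrier → Set
    isEquiv : IsEquivalence rel
    ∨-cong  : ∀ {a b c e} → rel a b → rel c e → rel (a ∨ c) (b ∨ e)
    ∧-cong  : ∀ {a b c e} → rel a b → rel c e → rel (a ∧ c) (b ∧ e)

record DMCong (M : DeMorganAlgebra) : Set₁ where
  open DeMorganAlgebra M
  field
    rel     : Carrier → Carrier → Set
    isEquiv : IsEquivalence rel
    ∨-cong  : ∀ {a b c e} → rel a b → rel c e → rel (a ∨ c) (b ∨ e)
    ∧-cong  : ∀ {a b c e} → rel a b → rel c e → rel (a ∧ c) (b ∧ e)
    °-cong  : ∀ {a b} → rel a b → rel (a °) (b °)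

_⊆_ : {X : Set} → (X → X → Set) → (X → X → Set) → Set
R ⊆ R' = ∀ {a b} → R a b → R' a b

_≐_ : {X : Set} → (X → X → Set) → (X → X → Set) → Set
R ≐ R' = (R ⊆ R') × (R' ⊆ R)

genLat : (L : BDLattice) → (BDLattice.Carrier L → BDLattice.Carrier L → Set) → LatCong L
genLat L R = record
  { rel = GenLat _∨_ _∧_ (λ _ → ⊤) R
  ; isEquiv = record { refl = g-refl tt ; sym = g-sym ; trans = g-trans }
  ; ∨-cong = g-∨-cong ; ∧-cong = g-∧-cong }
  where open BDLattice L

genDM : (M : DeMorganAlgebra) → (DeMorganAlgebra.Carrier M → DeMorganAlgebra.Carrier M → Set) → DMCong M
genDM M R = record
  { rel = GenDM _∨_ _∧_ _° (λ _ → ⊤) R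
  ; isEquiv = record { refl = g-refl tt ; sym = g-sym ; trans = g-trans }
  ; ∨-cong = g-∨-cong ; ∧-cong = g-∧-cong ; °-cong = g-°-cong }
  where open DeMorganAlgebra M

_⊓L_ : {L : BDLattice} → LatCong L → LatCong L → LatCong L
θ ⊓L φ = record
  { rel = λ a b → LatCong.rel θ a b × LatCong.rel φ a b
  ; isEquiv = record
      { refl = IsEquivalence.refl (LatCong.isEquiv θ) , IsEquivalence.refl (LatCong.isEquiv φ)
      ; sym = λ (p , q) → IsEquivalence.sym (LatCong.isEquiv θ) p , IsEquivalence.sym (LatCong.isEquiv φ) q
      ; trans = λ (p , q) (p' , q') → IsEquivalence.trans (LatCong.isEquiv θ) p p' , IsEquivalence.trans (LatCong.isEquiv φ) q q' }
  ; ∨-cong = λ (p , q) (p' , q') → LatCong.∨-cong θ p p' , LatCong.∨-cong φ q q'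
  ; ∧-cong = λ (p , q) (p' , q') → LatCong.∧-cong θ p p' , LatCong.∧-cong φ q q' }

_⊓M_ : {M : DeMorganAlgebra} → DMCong M → DMCong M → DMCong M
θ ⊓M φ = record
  { rel = λ a b → DMCong.rel θ a b × DMCong.rel φ a b
  ; isEquiv = record
      { refl = IsEquivalence.refl (DMCong.isEquiv θ) , IsEquivalence.refl (DMCong.isEquiv φ)
      ; sym = λ (p , q) → IsEquivalence.sym (DMCong.isEquiv θ) p , IsEquivalence.sym (DMCong.isEquiv φ) q
      ; trans = λ (p , q) (p' , q') → IsEquivalence.trans (DMCong.isEquiv θ) p p' , IsEquivalence.trans (DMCong.isEquiv φ) q q' }
  ; ∨-cong = λ (p , q) (p' , q') → DMCong.∨-cong θ p p' , DMCong.∨-cong φ q q'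
  ; ∧-cong = λ (p , q) (p' , q') → DMCong.∧-cong θ p p' , DMCong.∧-cong φ q q'
  ; °-cong = λ (p , q) → DMCong.°-cong θ p , DMCong.°-cong φ q }

_⊔L_ : {L : BDLattice} → LatCong L → LatCong L → LatCong L
_⊔L_ {L} θ φ = genLat L (λ a b → LatCong.rel θ a b ⊎ LatCong.rel φ a b)

_⊔M_ : {M : DeMorganAlgebra} → DMCong M → DMCong M → DMCong M
_⊔M_ {M} θ φ = genDM M (λ a b → DMCong.rel θ a b ⊎ DMCong.rel φ a b)

⋁L : {L : BDLattice} {I : Set} → (I → LatCong L) → LatCong L
⋁L {L} {I} θ = genLat L (λ a b → Σ[ i ∈ I ] LatCong.rel (θ i) a b)

⋁M : {M : DeMorganAlgebra} {I : Set} → (I → DMCong M) → DMCong M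
⋁M {M} {I} θ = genDM M (λ a b → Σ[ i ∈ I ] DMCong.rel (θ i) a b)

module _ (M : DeMorganAlgebra) where
  open DeMorganAlgebra M

  InB : Carrier → Set
  InB x = x ∨ (x °) ≡ 1#

  -- a congruence of the subalgebra B(M), given as a relation on the
  -- carrier of which only the pairs inside B(M) matter
  record IsBCong (R : Carrier → Carrier → Set) : Set where
    field
      reflB  : ∀ {a} → InB a → R a a
      symB   : ∀ {a b} → InB a → InB b → R a b → R b a
      transB : ∀ {a b c} → InB a → InB b → InB c → R a b → R b c → R a c
      ∨-congB : ∀ {a b c e} → InB a → InB b → InB c → InB e → R a b → R c e → R (a ∨ c) (b ∨ e)
      ∧-congB : ∀ {a b c e} → InB a → InB b → InB c → InB e → R a b → R c e → R (a ∧ c) (b ∧ e)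
      °-congB : ∀ {a b} → InB a → InB b → R a b → R (a °) (b °)

  Extends : DMCong M → (Carrier → Carrier → Set) → Set
  Extends θ R = ∀ a b → InB a → InB b → (DMCong.rel θ a b ⇔ R a b)

  PerfectExtensionOfB : Set₁
  PerfectExtensionOfB =
    ∀ (R : Carrier → Carrier → Set) → IsBCong R →
      (Σ[ θ ∈ DMCong M ] Extends θ R) ×
      (∀ θ θ' → Extends θ R → Extends θ' R → DMCong.rel θ ≐ DMCong.rel θ')

  principal0 : Carrier → DMCong M
  principal0 a = genDM M (λ x y → (x ≡ 0#) × (y ≡ a))

record BoundedLatHom (K L : BDLattice) : Set where
  private module K = BDLattice K
  private module L = BDLattice L
  field
    fun   : K.Carrier → L.Carrier
    ∨-hom : ∀ x y → fun (x K.∨ y) ≡ fun x L.∨ fun y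
    ∧-hom : ∀ x y → fun (x K.∧ y) ≡ fun x L.∧ fun y
    0-hom : fun K.0# ≡ L.0#
    1-hom : fun K.1# ≡ L.1#

record IsoToL°° (M : DeMorganAlgebra) (L : PrincipalMS) : Set where
  private module M = DeMorganAlgebra M
  private module L = PrincipalMS L
  field
    fun   : M.Carrier → L.Carrier
    into  : ∀ x → L.InL°° (fun x)
    ∨-hom : ∀ x y → fun (x M.∨ y) ≡ fun x L.∨ fun y
    ∧-hom : ∀ x y → fun (x M.∧ y) ≡ fun x L.∧ fun y
    °-hom : ∀ x → fun (x M.°) ≡ (fun x) L.°
    0-hom : fun M.0# ≡ L.0#
    1-hom : fun M.1# ≡ L.1#
    injective : ∀ x y → fun x ≡ fun y → x ≡ y
    onto  : ∀ y → L.InL°° y → Σ[ x ∈ M.Carrier ] fun x ≡ y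

-- bounded lattice isomorphism τ₂ : D → D(L) (bounds of D(L): d_L and 1)
record IsoToD (D : BDLattice) (L : PrincipalMS) : Set where
  private module D = BDLattice D
  private module L = PrincipalMS L
  field
    fun   : D.Carrier → L.Carrier
    into  : ∀ x → L.InD (fun x)
    ∨-hom : ∀ x y → fun (x D.∨ y) ≡ fun x L.∨ fun y
    ∧-hom : ∀ x y → fun (x D.∧ y) ≡ fun x L.∧ fun y
    0-hom : fun D.0# ≡ L.d
    1-hom : fun D.1# ≡ L.1#
    injective : ∀ x y → fun x ≡ fun y → x ≡ y
    onto  : ∀ y → L.InD y → Σ[ x ∈ D.Carrier ] fun x ≡ y

Img : {X Y : Set} → (X → Y) → (X → X → Set) → Y → Y → Set
Img {X} f R a b = Σ[ x ∈ X ] Σ[ y ∈ X ] R x y × (f x ≡ a) × (f y ≡ b)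

module _ (L : PrincipalMS) where
  open PrincipalMS L

  Con-τ₁ : {M : DeMorganAlgebra} → IsoToL°° M L → DMCong M → Carrier → Carrier → Set
  Con-τ₁ τ θ = GenDM _∨_ _∧_ _° InL°° (Img (IsoToL°°.fun τ) (DMCong.rel θ))

  Con-τ₂ : {D : BDLattice} → IsoToD D L → LatCong D → Carrier → Carrier → Set
  Con-τ₂ τ θ = GenLat _∨_ _∧_ InD (Img (IsoToD.fun τ) (LatCong.rel θ))

  InA : (Carrier → Carrier → Set) → (Carrier → Carrier → Set) → Set
  InA ρ₁ ρ₂ = ∀ a b → InL°° a → InL°° b → ρ₁ a b → ρ₂ (a ∨ d) (b ∨ d)

module _ (M : DeMorganAlgebra) (D : BDLattice) where
  ConSubset : Set₁
  ConSubset = DMCong M → LatCong D → Set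

  RespectsEq : ConSubset → Set₁
  RespectsEq A = ∀ θ₁ θ₁' θ₂ θ₂' → DMCong.rel θ₁ ≐ DMCong.rel θ₁' →
    LatCong.rel θ₂ ≐ LatCong.rel θ₂' → A θ₁ θ₂ → A θ₁' θ₂'

  IsSublattice : ConSubset → Set₁
  IsSublattice A = ∀ θ₁ θ₂ θ₁' θ₂' → A θ₁ θ₂ → A θ₁' θ₂' →
    A (θ₁ ⊓M θ₁') (θ₂ ⊓L θ₂') × A (θ₁ ⊔M θ₁') (θ₂ ⊔L θ₂')

  Representable : ConSubset → Set₁
  Representable A =
    Σ[ L ∈ PrincipalMS ] Σ[ τ₁ ∈ IsoToL°° M L ] Σ[ τ₂ ∈ IsoToD D L ]
      (∀ θ₁ θ₂ → (A θ₁ θ₂ ⇔ InA L (Con-τ₁ L τ₁ θ₁) (Con-τ₂ L τ₂ θ₂)))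

  JoinClosed : ConSubset → Set₁
  JoinClosed A = ∀ (I : Set) (θ₁ : I → DMCong M) (θ₂ : I → LatCong D) →
    (∀ i → A (θ₁ i) (θ₂ i)) → A (⋁M θ₁) (⋁L θ₂)

  DownClosed₁ : ConSubset → Set₁
  DownClosed₁ A = ∀ θ₁ θ₂ (α : DMCong M) → A θ₁ θ₂ →
    DMCong.rel α ⊆ DMCong.rel θ₁ → A α θ₂

  Con-φ : BoundedLatHom (MSAlgebra.lattice (DeMorganAlgebra.msAlgebra M)) D →
          DMCong M → LatCong D
  Con-φ φ α = genLat D (Img (BoundedLatHom.fun φ) (DMCong.rel α))

  Condition3 : ConSubset → Set₁
  Condition3 A =
    Σ[ φ ∈ BoundedLatHom (MSAlgebra.lattice (DeMorganAlgebra.msAlgebra M)) D ]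
      (∀ a → InB M a → ∀ (θ₂ : LatCong D) →
        (A (principal0 M a) θ₂ ⇔ (LatCong.rel (Con-φ φ (principal0 M a)) ⊆ LatCong.rel θ₂)))

module Submission where

-- For a lattice (0,1)-homomorphism φ : M → D call a pair (θ₁, θ₂)
-- φ-compatible when Con(φ)(θ₁) ⊆ θ₂, i.e. θ₁ ⊆ φ⁻¹(θ₂).  The proof shows
-- that a subset A is representable iff it is the set of φ-compatible pairs
-- for some φ, and that under the perfect-extension hypothesis this holds
-- iff A satisfies (1)–(3).
--  * Pair correspondence: if L, τ₁, τ₂ represent M and D and φ satisfies
--    τ₂(φ a) = τ₁(a) ∨ d_L, then (Con τ₁ θ₁, Con τ₂ θ₂) ∈ A(L) iff (θ₁, θ₂)
--    is φ-compatible.  Every representation yields such a φ, namely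
--    a ↦ τ₂⁻¹(τ₁ a ∨ d_L); conversely every φ arises from the principal
--    MS-algebra {(a, x) ∈ M × D | x ≤ φ a}.
--  * φ-compatible pairs are closed under arbitrary joins and down-closed in
--    the first coordinate, and satisfy (3) by definition.
--  * If M is a perfect extension of B(M), every congruence is the join of
--    the principal congruences θ(0,a), a ∈ B(M), below it; with (1)–(3)
--    this forces A to be exactly the φ-compatible pairs.

open import Defs
open import Level using (0ℓ)
open import Data.Product using (Σ; Σ-syntax; _×_; _,_; proj₁; proj₂)
open import Data.Unit using (tt)
open import Function using (_∘_; id)
open import Function.Bundles using (_⇔_; mk⇔; Equivalence)
open import Function.Construct.Composition using (_⇔-∘_)
open import Function.Construct.Symmetry using (⇔-sym)
open import Relation.Binary.PropositionalEquality
open import Relation.Binary.Structures using (IsEquivalence)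
open import Algebra.Core using (Op₁; Op₂)
open import Algebra.Lattice.Bundles using (Lattice)
open import Axiom.UniquenessOfIdentityProofs.WithK using (uip)
import Algebra.Lattice.Structures as LS
import Algebra.Lattice.Properties.Lattice as LatticeProperties
open Equivalence using (to; from)

module LatticeLaws (L : BDLattice) where
  open BDLattice L
  open LS.IsDistributiveLattice isDistributiveLattice public
    using ( isLattice; ∨-comm; ∨-assoc; ∧-comm; ∧-assoc; ∨-absorbs-∧; ∧-absorbs-∨
          ; ∨-distribˡ-∧; ∨-distribʳ-∧; ∧-distribˡ-∨; ∧-distribʳ-∨ )
  open ≡-Reasoning

  asLattice : Lattice 0ℓ 0ℓ
  asLattice = record
    { Carrier = Carrier ; _≈_ = _≡_ ; _∨_ = _∨_ ; _∧_ = _∧_ ; isLattice = isLattice }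

  open LatticeProperties asLattice public using (∧-idem; ∨-idem)

  ∨-identityʳ : ∀ x → x ∨ 0# ≡ x
  ∨-identityʳ x = trans (∨-comm x 0#) (0-least x)

  ∧-identityʳ : ∀ x → x ∧ 1# ≡ x
  ∧-identityʳ x = trans (∧-comm x 1#) (1-greatest x)

  ∨-zeroˡ : ∀ x → 1# ∨ x ≡ 1#
  ∨-zeroˡ x = trans (sym (1-greatest (1# ∨ x))) (∧-absorbs-∨ 1# x)

  ∨-zeroʳ : ∀ x → x ∨ 1# ≡ 1#
  ∨-zeroʳ x = trans (∨-comm x 1#) (∨-zeroˡ x)

  ∧-zeroˡ : ∀ x → 0# ∧ x ≡ 0#
  ∧-zeroˡ x = trans (cong (0# ∧_) (sym (0-least x))) (∧-absorbs-∨ 0# x)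

  ≤-trans : ∀ {x y z} → x ≤ y → y ≤ z → x ≤ z
  ≤-trans {x} {y} {z} x≤y y≤z = begin
    x ∧ z        ≡⟨ cong (_∧ z) (sym x≤y) ⟩
    (x ∧ y) ∧ z  ≡⟨ ∧-assoc x y z ⟩
    x ∧ (y ∧ z)  ≡⟨ cong (x ∧_) y≤z ⟩
    x ∧ y        ≡⟨ x≤y ⟩
    x            ∎

  x≤x∨y : ∀ x y → x ≤ (x ∨ y)
  x≤x∨y = ∧-absorbs-∨

  y≤x∨y : ∀ x y → y ≤ (x ∨ y)
  y≤x∨y x y = trans (cong (y ∧_) (∨-comm x y)) (∧-absorbs-∨ y x)

  ∨-mono-≤ : ∀ {x y u v} → x ≤ u → y ≤ v → (x ∨ y) ≤ (u ∨ v)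
  ∨-mono-≤ {x} {y} {u} {v} x≤u y≤v = begin
    (x ∨ y) ∧ (u ∨ v)              ≡⟨ ∧-distribʳ-∨ (u ∨ v) x y ⟩
    (x ∧ (u ∨ v)) ∨ (y ∧ (u ∨ v))  ≡⟨ cong₂ _∨_ (≤-trans x≤u (x≤x∨y u v))
                                                (≤-trans y≤v (y≤x∨y u v)) ⟩
    x ∨ y                          ∎

  ∧-mono-≤ : ∀ {x y u v} → x ≤ u → y ≤ v → (x ∧ y) ≤ (u ∧ v)
  ∧-mono-≤ {x} {y} {u} {v} x≤u y≤v = begin
    (x ∧ y) ∧ (u ∧ v)  ≡⟨ ∧-assoc x y (u ∧ v) ⟩
    x ∧ (y ∧ (u ∧ v))  ≡⟨ cong (x ∧_) (sym (∧-assoc y u v)) ⟩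
    x ∧ ((y ∧ u) ∧ v)  ≡⟨ cong (λ t → x ∧ (t ∧ v)) (∧-comm y u) ⟩
    x ∧ ((u ∧ y) ∧ v)  ≡⟨ cong (x ∧_) (∧-assoc u y v) ⟩
    x ∧ (u ∧ (y ∧ v))  ≡⟨ sym (∧-assoc x u (y ∧ v)) ⟩
    (x ∧ u) ∧ (y ∧ v)  ≡⟨ cong₂ _∧_ x≤u y≤v ⟩
    x ∧ y              ∎

  ∨-distribʳ-∨ : ∀ u v d → (u ∨ v) ∨ d ≡ (u ∨ d) ∨ (v ∨ d)
  ∨-distribʳ-∨ u v d = sym (begin
    (u ∨ d) ∨ (v ∨ d)  ≡⟨ ∨-assoc u d (v ∨ d) ⟩
    u ∨ (d ∨ (v ∨ d))  ≡⟨ cong (u ∨_) (∨-comm d (v ∨ d)) ⟩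
    u ∨ ((v ∨ d) ∨ d)  ≡⟨ cong (u ∨_) (∨-assoc v d d) ⟩
    u ∨ (v ∨ (d ∨ d))  ≡⟨ cong (λ t → u ∨ (v ∨ t)) (∨-idem d) ⟩
    u ∨ (v ∨ d)        ≡⟨ sym (∨-assoc u v d) ⟩
    (u ∨ v) ∨ d        ∎)

module DeMorganLaws (M : DeMorganAlgebra) where
  open DeMorganAlgebra M public
  open LatticeLaws lattice public
  open ≡-Reasoning

  0° : 0# ° ≡ 1#
  0° = trans (cong _° (sym 1°)) (°° 1#)

  °-∨ : ∀ x y → (x ∨ y) ° ≡ (x °) ∧ (y °)
  °-∨ x y = begin
    (x ∨ y) °              ≡⟨ cong _° (sym (cong₂ _∨_ (°° x) (°° y))) ⟩
    ((x °) ° ∨ (y °) °) °  ≡⟨ cong _° (sym (°-∧ (x °) (y °))) ⟩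
    ((x ° ∧ y °) °) °      ≡⟨ °° _ ⟩
    x ° ∧ y °              ∎

  °≡0⇒≡1 : ∀ a → a ° ≡ 0# → a ≡ 1#
  °≡0⇒≡1 a a°≡0 = trans (sym (°° a)) (trans (cong _° a°≡0) 0°)

  B-complement : ∀ c → InB M c → (c °) ∧ c ≡ 0#
  B-complement c c∈B = begin
    c ° ∧ c              ≡⟨ sym (°° _) ⟩
    ((c ° ∧ c) °) °      ≡⟨ cong _° (°-∧ (c °) c) ⟩
    ((c °) ° ∨ c °) °    ≡⟨ cong (λ t → (t ∨ c °) °) (°° c) ⟩
    (c ∨ c °) °          ≡⟨ cong _° c∈B ⟩
    1# °                 ≡⟨ 1° ⟩
    0#                   ∎

  B-absorb : ∀ x y → InB M x → x ∨ (x ° ∧ y) ≡ x ∨ y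
  B-absorb x y x∈B = begin
    x ∨ (x ° ∧ y)        ≡⟨ ∨-distribˡ-∧ x (x °) y ⟩
    (x ∨ x °) ∧ (x ∨ y)  ≡⟨ cong (_∧ (x ∨ y)) x∈B ⟩
    1# ∧ (x ∨ y)         ≡⟨ 1-greatest _ ⟩
    x ∨ y                ∎

  B-0 : InB M 0#
  B-0 = trans (0-least (0# °)) 0°

  B-° : ∀ c → InB M c → InB M (c °)
  B-° c c∈B = trans (cong (c ° ∨_) (°° c)) (trans (∨-comm (c °) c) c∈B)

  B-∧ : ∀ x y → InB M x → InB M y → InB M (x ∧ y)
  B-∧ x y x∈B y∈B = begin
    (x ∧ y) ∨ (x ∧ y) °                    ≡⟨ cong ((x ∧ y) ∨_) (°-∧ x y) ⟩
    (x ∧ y) ∨ (x ° ∨ y °)                  ≡⟨ ∨-comm (x ∧ y) _ ⟩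
    (x ° ∨ y °) ∨ (x ∧ y)                  ≡⟨ ∨-distribˡ-∧ _ x y ⟩
    ((x ° ∨ y °) ∨ x) ∧ ((x ° ∨ y °) ∨ y)  ≡⟨ cong₂ _∧_ x-side y-side ⟩
    1# ∧ 1#                                ≡⟨ 1-greatest 1# ⟩
    1#                                     ∎
    where
    x-side : (x ° ∨ y °) ∨ x ≡ 1#
    x-side = begin
      (x ° ∨ y °) ∨ x  ≡⟨ ∨-comm _ x ⟩
      x ∨ (x ° ∨ y °)  ≡⟨ sym (∨-assoc x (x °) (y °)) ⟩
      (x ∨ x °) ∨ y °  ≡⟨ cong (_∨ y °) x∈B ⟩
      1# ∨ y °         ≡⟨ ∨-zeroˡ _ ⟩
      1#               ∎
    y-side : (x ° ∨ y °) ∨ y ≡ 1#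
    y-side = begin
      (x ° ∨ y °) ∨ y  ≡⟨ ∨-assoc (x °) (y °) y ⟩
      x ° ∨ (y ° ∨ y)  ≡⟨ cong (x ° ∨_) (trans (∨-comm (y °) y) y∈B) ⟩
      x ° ∨ 1#         ≡⟨ ∨-zeroʳ _ ⟩
      1#               ∎

module _ {L : BDLattice} where
  open BDLattice L

  genLat-least : ∀ {S R} (θ : LatCong L) → R ⊆ LatCong.rel θ →
                 GenLat _∨_ _∧_ S R ⊆ LatCong.rel θ
  genLat-least {S} {R} θ R⊆θ = go
    where
    open LatCong θ
    module E = IsEquivalence isEquiv
    go : GenLat _∨_ _∧_ S R ⊆ rel
    go (g-base r)       = R⊆θ r
    go (g-refl _)       = E.refl
    go (g-sym p)        = E.sym (go p)
    go (g-trans p q)    = E.trans (go p) (go q)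
    go (g-∨-cong p q)   = ∨-cong (go p) (go q)
    go (g-∧-cong p q)   = ∧-cong (go p) (go q)

module _ {M : DeMorganAlgebra} where
  open DeMorganAlgebra M

  genDM-least : ∀ {S R} (θ : DMCong M) → R ⊆ DMCong.rel θ →
                GenDM _∨_ _∧_ _° S R ⊆ DMCong.rel θ
  genDM-least {S} {R} θ R⊆θ = go
    where
    open DMCong θ
    module E = IsEquivalence isEquiv
    go : GenDM _∨_ _∧_ _° S R ⊆ rel
    go (g-base r)       = R⊆θ r
    go (g-refl _)       = E.refl
    go (g-sym p)        = E.sym (go p)
    go (g-trans p q)    = E.trans (go p) (go q)
    go (g-∨-cong p q)   = ∨-cong (go p) (go q)
    go (g-∧-cong p q)   = ∧-cong (go p) (go q)
    go (g-°-cong p)     = °-cong (go p)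

module ImageUnderInjection {X Y : Set} (f : X → Y)
  (f-injective : ∀ x y → f x ≡ f y → x ≡ y)
  {R : X → X → Set} (R-equiv : IsEquivalence R) where
  private module E = IsEquivalence R-equiv

  img-refl : ∀ x → Img f R (f x) (f x)
  img-refl x = x , x , E.refl , refl , refl

  img-sym : ∀ {a b} → Img f R a b → Img f R b a
  img-sym (x , y , r , refl , refl) = y , x , E.sym r , refl , refl

  img-trans : ∀ {a b c} → Img f R a b → Img f R b c → Img f R a c
  img-trans (x , y , r , refl , refl) (y' , z , r' , fy'≡fy , refl) =
    x , z , E.trans r (subst (λ t → R t z) (f-injective y' y fy'≡fy) r') , refl , refl

  img-op₂ : {_∙_ : Op₂ X} {_⊙_ : Op₂ Y} → (∀ x y → f (x ∙ y) ≡ f x ⊙ f y) →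
            (∀ {a b c e} → R a b → R c e → R (a ∙ c) (b ∙ e)) →
            ∀ {a b c e} → Img f R a b → Img f R c e → Img f R (a ⊙ c) (b ⊙ e)
  img-op₂ {_∙_} hom R-cong (x , y , r , refl , refl) (x' , y' , r' , refl , refl) =
    x ∙ x' , y ∙ y' , R-cong r r' , hom x x' , hom y y'

  img-op₁ : {g : Op₁ X} {h : Op₁ Y} → (∀ x → f (g x) ≡ h (f x)) →
            (∀ {a b} → R a b → R (g a) (g b)) →
            ∀ {a b} → Img f R a b → Img f R (h a) (h b)
  img-op₁ {g} hom R-cong (x , y , r , refl , refl) = g x , g y , R-cong r , hom x , hom y

preimage : {K L : BDLattice} → BoundedLatHom K L → LatCong L → LatCong K
preimage φ κ = record
  { rel = λ a b → rel (fun a) (fun b)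
  ; isEquiv = record { refl = E.refl ; sym = E.sym ; trans = E.trans }
  ; ∨-cong = λ {a} {b} {c} {e} p q →
      subst₂ rel (sym (∨-hom a c)) (sym (∨-hom b e)) (∨-cong p q)
  ; ∧-cong = λ {a} {b} {c} {e} p q →
      subst₂ rel (sym (∧-hom a c)) (sym (∧-hom b e)) (∧-cong p q) }
  where
  open BoundedLatHom φ
  open LatCong κ
  module E = IsEquivalence isEquiv

⋁L-const : {L : BDLattice} {I : Set} → I → (θ : LatCong L) →
           LatCong.rel (⋁L {L} {I} (λ _ → θ)) ≐ LatCong.rel θ
⋁L-const i θ = genLat-least θ proj₂ , λ p → g-base (i , p)

module _ {M : DeMorganAlgebra} where
  open DeMorganLaws M

  -- The pairs (a, b) with (a, b) and (a°, b°) in κ form the largest de Morgan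
  -- congruence inside the lattice congruence κ.
  °-core : LatCong lattice → DMCong M
  °-core κ = record
    { rel = λ a b → rel a b × rel (a °) (b °)
    ; isEquiv = record
        { refl = E.refl , E.refl
        ; sym = λ (p , p°) → E.sym p , E.sym p°
        ; trans = λ (p , p°) (q , q°) → E.trans p q , E.trans p° q° }
    ; ∨-cong = λ {a} {b} {c} {e} (p , p°) (q , q°) →
        ∨-cong p q , subst₂ rel (sym (°-∨ a c)) (sym (°-∨ b e)) (∧-cong p° q°)
    ; ∧-cong = λ {a} {b} {c} {e} (p , p°) (q , q°) →
        ∧-cong p q , subst₂ rel (sym (°-∧ a c)) (sym (°-∧ b e)) (∨-cong p° q°)
    ; °-cong = λ {a} {b} (p , p°) → p° , subst₂ rel (sym (°° a)) (sym (°° b)) p }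
    where
    open LatCong κ
    module E = IsEquivalence isEquiv

  ⋁M-below : {I : Set} (θ : I → DMCong M) (κ : LatCong lattice) →
             (∀ i → DMCong.rel (θ i) ⊆ LatCong.rel κ) →
             DMCong.rel (⋁M θ) ⊆ LatCong.rel κ
  ⋁M-below {I} θ κ θᵢ⊆κ p = proj₁ (genDM-least (°-core κ) in-core p)
    where
    in-core : (λ a b → Σ[ i ∈ I ] DMCong.rel (θ i) a b) ⊆ DMCong.rel (°-core κ)
    in-core (i , r) = θᵢ⊆κ i r , θᵢ⊆κ i (DMCong.°-cong (θ i) r)

  principal0-below : (θ : DMCong M) → ∀ {a} → DMCong.rel θ 0# a →
                     DMCong.rel (principal0 M a) ⊆ DMCong.rel θ
  principal0-below θ 0θa = genDM-least θ (λ { (refl , refl) → 0θa })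

  PrincipalBelow : DMCong M → Set
  PrincipalBelow θ = Σ[ a ∈ Carrier ] InB M a × (DMCong.rel (principal0 M a) ⊆ DMCong.rel θ)

  principalsBelow : DMCong M → DMCong M
  principalsBelow θ = ⋁M {M} {PrincipalBelow θ} (principal0 M ∘ proj₁)

  zero-below : (θ : DMCong M) → PrincipalBelow θ
  zero-below θ = 0# , B-0 , principal0-below θ (IsEquivalence.refl (DMCong.isEquiv θ))

  -- On B(M), θ and the join of the principal congruences below it agree:
  -- for b θ c put a = b° ∧ c ∈ B(M); then 0 = c° ∧ c θ a, and
  -- b = b ∨ 0 ≡ b ∨ a = b ∨ c modulo θ(0,a).  By symmetry c ≡ c ∨ b.
  principalsBelow-on-B : (θ : DMCong M) → ∀ {b c} → InB M b → InB M c →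
                         DMCong.rel θ b c → DMCong.rel (principalsBelow θ) b c
  principalsBelow-on-B θ {b} {c} b∈B c∈B bθc =
    g-trans (b≡b∨c b∈B c∈B bθc)
      (g-sym (subst (DMCong.rel (principalsBelow θ) c) (∨-comm c b)
               (b≡b∨c c∈B b∈B (E.sym bθc))))
    where
    module E = IsEquivalence (DMCong.isEquiv θ)
    b≡b∨c : ∀ {b c} → InB M b → InB M c → DMCong.rel θ b c →
            DMCong.rel (principalsBelow θ) b (b ∨ c)
    b≡b∨c {b} {c} b∈B c∈B bθc = g-base (below , in-principal)
      where
      a = b ° ∧ c
      0θa : DMCong.rel θ 0# a
      0θa = E.sym (subst (DMCong.rel θ a) (B-complement c c∈B)
                    (DMCong.∧-cong θ (DMCong.°-cong θ bθc) E.refl))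
      below : PrincipalBelow θ
      below = a , B-∧ _ _ (B-° b b∈B) c∈B , principal0-below θ 0θa
      in-principal : DMCong.rel (principal0 M a) b (b ∨ c)
      in-principal = subst₂ (DMCong.rel (principal0 M a)) (∨-identityʳ b) (B-absorb b c b∈B)
                       (g-∨-cong (g-refl tt) (g-base (refl , refl)))

  restrictionToB : (θ : DMCong M) → IsBCong M (DMCong.rel θ)
  restrictionToB θ = record
    { reflB = λ _ → E.refl ; symB = λ _ _ → E.sym ; transB = λ _ _ _ → E.trans
    ; ∨-congB = λ _ _ _ _ → ∨-cong ; ∧-congB = λ _ _ _ _ → ∧-cong ; °-congB = λ _ _ → °-cong }
    where
    open DMCong θ
    module E = IsEquivalence isEquiv

  -- In a perfect extension of B(M) every congruence is the join of the
  -- principal congruences θ(0,a), a ∈ B(M), below it: both congruences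
  -- extend the restriction of θ to B(M).
  join-of-principals : PerfectExtensionOfB M → (θ : DMCong M) →
                       DMCong.rel θ ≐ DMCong.rel (principalsBelow θ)
  join-of-principals PE θ =
    proj₂ (PE (DMCong.rel θ) (restrictionToB θ)) θ (principalsBelow θ)
      (λ _ _ _ _ → mk⇔ id id)
      (λ _ _ b∈B c∈B → mk⇔ principalsBelow⊆θ (principalsBelow-on-B θ b∈B c∈B))
    where
    principalsBelow⊆θ : DMCong.rel (principalsBelow θ) ⊆ DMCong.rel θ
    principalsBelow⊆θ = genDM-least θ (λ { ((_ , _ , θ₀ₐ⊆θ) , p) → θ₀ₐ⊆θ p })

module _ (M : DeMorganAlgebra) (D : BDLattice) where
  private
    module M = DeMorganLaws M
    module D = BDLattice D

  MLat : BDLattice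
  MLat = DeMorganAlgebra.lattice M

  Compatible : BoundedLatHom MLat D → DMCong M → LatCong D → Set
  Compatible φ θ₁ θ₂ = LatCong.rel (Con-φ M D φ θ₁) ⊆ LatCong.rel θ₂

  DescribedBy : BoundedLatHom MLat D → ConSubset M D → Set₁
  DescribedBy φ A = ∀ θ₁ θ₂ → A θ₁ θ₂ ⇔ Compatible φ θ₁ θ₂

  module PairCorrespondence (L : PrincipalMS) (τ₁ : IsoToL°° M L) (τ₂ : IsoToD D L)
    (φ : BoundedLatHom MLat D)
    (φ-spec : ∀ a → IsoToD.fun τ₂ (BoundedLatHom.fun φ a) ≡
                    PrincipalMS._∨_ L (IsoToL°°.fun τ₁ a) (PrincipalMS.d L)) where
    private
      module L = PrincipalMS L
      module T₁ = IsoToL°° τ₁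
      module T₂ = IsoToD τ₂
      module F = BoundedLatHom φ

    -- Since τ₁ is an isomorphism onto L°°, Con(τ₁)(θ₁) is just the image of θ₁.
    Con-τ₁-is-image : (θ₁ : DMCong M) → Con-τ₁ L τ₁ θ₁ ⊆ Img T₁.fun (DMCong.rel θ₁)
    Con-τ₁-is-image θ₁ = go
      where
      open DMCong θ₁
      open ImageUnderInjection T₁.fun T₁.injective isEquiv
      go : Con-τ₁ L τ₁ θ₁ ⊆ Img T₁.fun rel
      go (g-base p)      = p
      go (g-refl s)      with T₁.onto _ s
      ... | x , refl     = img-refl x
      go (g-sym p)       = img-sym (go p)
      go (g-trans p q)   = img-trans (go p) (go q)
      go (g-∨-cong p q)  = img-op₂ T₁.∨-hom ∨-cong (go p) (go q)
      go (g-∧-cong p q)  = img-op₂ T₁.∧-hom ∧-cong (go p) (go q)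
      go (g-°-cong p)    = img-op₁ T₁.°-hom °-cong (go p)

    Con-τ₂-is-image : (θ₂ : LatCong D) → Con-τ₂ L τ₂ θ₂ ⊆ Img T₂.fun (LatCong.rel θ₂)
    Con-τ₂-is-image θ₂ = go
      where
      open LatCong θ₂
      open ImageUnderInjection T₂.fun T₂.injective isEquiv
      go : Con-τ₂ L τ₂ θ₂ ⊆ Img T₂.fun rel
      go (g-base p)      = p
      go (g-refl s)      with T₂.onto _ s
      ... | x , refl     = img-refl x
      go (g-sym p)       = img-sym (go p)
      go (g-trans p q)   = img-trans (go p) (go q)
      go (g-∨-cong p q)  = img-op₂ T₂.∨-hom ∨-cong (go p) (go q)
      go (g-∧-cong p q)  = img-op₂ T₂.∧-hom ∧-cong (go p) (go q)

    -- (a, b) ∈ Con τ₁ θ₁ comes from (x, y) ∈ θ₁, and a ∨ d_L = τ₂(φ x), so the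
    -- A(L)-condition on (a, b) is exactly (φ x, φ y) ∈ θ₂.
    inA⇔compatible : ∀ θ₁ θ₂ →
      InA L (Con-τ₁ L τ₁ θ₁) (Con-τ₂ L τ₂ θ₂) ⇔ Compatible φ θ₁ θ₂
    inA⇔compatible θ₁ θ₂ = mk⇔ inA⇒compatible compatible⇒inA
      where
      inA⇒compatible : InA L (Con-τ₁ L τ₁ θ₁) (Con-τ₂ L τ₂ θ₂) → Compatible φ θ₁ θ₂
      inA⇒compatible inA = genLat-least θ₂ image⊆θ₂
        where
        image⊆θ₂ : Img F.fun (DMCong.rel θ₁) ⊆ LatCong.rel θ₂
        image⊆θ₂ (x , y , r , refl , refl)
          with Con-τ₂-is-image θ₂
                 (subst₂ (Con-τ₂ L τ₂ θ₂) (sym (φ-spec x)) (sym (φ-spec y))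
                   (inA _ _ (T₁.into x) (T₁.into y) (g-base (x , y , r , refl , refl))))
        ... | u , v , r' , τ₂u≡ , τ₂v≡ =
          subst₂ (LatCong.rel θ₂) (T₂.injective u (F.fun x) τ₂u≡) (T₂.injective v (F.fun y) τ₂v≡) r'
      compatible⇒inA : Compatible φ θ₁ θ₂ → InA L (Con-τ₁ L τ₁ θ₁) (Con-τ₂ L τ₂ θ₂)
      compatible⇒inA compatible _ _ _ _ p with Con-τ₁-is-image θ₁ p
      ... | x , y , r , refl , refl =
        subst₂ (Con-τ₂ L τ₂ θ₂) (φ-spec x) (φ-spec y)
          (g-base (F.fun x , F.fun y , compatible (g-base (x , y , r , refl , refl)) , refl , refl))

  module HomOfRepresentation (L : PrincipalMS) (τ₁ : IsoToL°° M L) (τ₂ : IsoToD D L) where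
    private
      module L = PrincipalMS L
      module LL = LatticeLaws L.lattice
      module T₁ = IsoToL°° τ₁
      module T₂ = IsoToD τ₂
    open ≡-Reasoning

    τ₁∨d∈D : ∀ a → L.InD (T₁.fun a L.∨ L.d)
    τ₁∨d∈D a = from (L.D-char _) (LL.y≤x∨y (T₁.fun a) L.d)

    f : M.Carrier → D.Carrier
    f a = proj₁ (T₂.onto _ (τ₁∨d∈D a))

    f-spec : ∀ a → T₂.fun (f a) ≡ T₁.fun a L.∨ L.d
    f-spec a = proj₂ (T₂.onto _ (τ₁∨d∈D a))

    φ : BoundedLatHom MLat D
    φ = record
      { fun = f
      ; ∨-hom = λ a b → T₂.injective _ _ (begin
          T₂.fun (f (a M.∨ b))                           ≡⟨ f-spec (a M.∨ b) ⟩
          T₁.fun (a M.∨ b) L.∨ L.d                       ≡⟨ cong (L._∨ L.d) (T₁.∨-hom a b) ⟩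
          (T₁.fun a L.∨ T₁.fun b) L.∨ L.d                ≡⟨ LL.∨-distribʳ-∨ _ _ _ ⟩
          (T₁.fun a L.∨ L.d) L.∨ (T₁.fun b L.∨ L.d)      ≡⟨ sym (cong₂ L._∨_ (f-spec a) (f-spec b)) ⟩
          T₂.fun (f a) L.∨ T₂.fun (f b)                  ≡⟨ sym (T₂.∨-hom _ _) ⟩
          T₂.fun (f a D.∨ f b)                           ∎)
      ; ∧-hom = λ a b → T₂.injective _ _ (begin
          T₂.fun (f (a M.∧ b))                           ≡⟨ f-spec (a M.∧ b) ⟩
          T₁.fun (a M.∧ b) L.∨ L.d                       ≡⟨ cong (L._∨ L.d) (T₁.∧-hom a b) ⟩
          (T₁.fun a L.∧ T₁.fun b) L.∨ L.d                ≡⟨ LL.∨-distribʳ-∧ _ _ _ ⟩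
          (T₁.fun a L.∨ L.d) L.∧ (T₁.fun b L.∨ L.d)      ≡⟨ sym (cong₂ L._∧_ (f-spec a) (f-spec b)) ⟩
          T₂.fun (f a) L.∧ T₂.fun (f b)                  ≡⟨ sym (T₂.∧-hom _ _) ⟩
          T₂.fun (f a D.∧ f b)                           ∎)
      ; 0-hom = T₂.injective _ _ (begin
          T₂.fun (f M.0#)        ≡⟨ f-spec M.0# ⟩
          T₁.fun M.0# L.∨ L.d    ≡⟨ cong (L._∨ L.d) T₁.0-hom ⟩
          L.0# L.∨ L.d           ≡⟨ L.0-least L.d ⟩
          L.d                    ≡⟨ sym T₂.0-hom ⟩
          T₂.fun D.0#            ∎)
      ; 1-hom = T₂.injective _ _ (begin
          T₂.fun (f M.1#)        ≡⟨ f-spec M.1# ⟩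
          T₁.fun M.1# L.∨ L.d    ≡⟨ cong (L._∨ L.d) T₁.1-hom ⟩
          L.1# L.∨ L.d           ≡⟨ LL.∨-zeroˡ L.d ⟩
          L.1#                   ≡⟨ sym T₂.1-hom ⟩
          T₂.fun D.1#            ∎) }

  representation⇒described : (A : ConSubset M D) → Representable M D A →
                             Σ[ φ ∈ BoundedLatHom MLat D ] DescribedBy φ A
  representation⇒described A (L , τ₁ , τ₂ , A⇔inA) =
    φ , λ θ₁ θ₂ → inA⇔compatible θ₁ θ₂ ⇔-∘ A⇔inA θ₁ θ₂
    where
    open HomOfRepresentation L τ₁ τ₂
    open PairCorrespondence L τ₁ τ₂ φ f-spec

  module _ (φ : BoundedLatHom MLat D) where

    compatible-intro : ∀ θ₁ θ₂ → DMCong.rel θ₁ ⊆ LatCong.rel (preimage φ θ₂) →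
                       Compatible φ θ₁ θ₂
    compatible-intro θ₁ θ₂ θ₁⊆φ⁻¹θ₂ =
      genLat-least θ₂ (λ { (_ , _ , r , refl , refl) → θ₁⊆φ⁻¹θ₂ r })

    compatible-elim : ∀ θ₁ θ₂ → Compatible φ θ₁ θ₂ →
                      DMCong.rel θ₁ ⊆ LatCong.rel (preimage φ θ₂)
    compatible-elim θ₁ θ₂ compatible r = compatible (g-base (_ , _ , r , refl , refl))

    compatible-joinClosed : JoinClosed M D (Compatible φ)
    compatible-joinClosed I θ₁ θ₂ compatibleᵢ =
      compatible-intro (⋁M θ₁) (⋁L θ₂)
        (⋁M-below θ₁ (preimage φ (⋁L θ₂))
          (λ i r → g-base (i , compatible-elim (θ₁ i) (θ₂ i) (compatibleᵢ i) r)))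

    compatible-downClosed : DownClosed₁ M D (Compatible φ)
    compatible-downClosed θ₁ θ₂ α compatible α⊆θ₁ =
      compatible-intro α θ₂ (λ r → compatible-elim θ₁ θ₂ compatible (α⊆θ₁ r))

  described⇒conditions : (A : ConSubset M D) (φ : BoundedLatHom MLat D) → DescribedBy φ A →
                         JoinClosed M D A × DownClosed₁ M D A × Condition3 M D A
  described⇒conditions A φ A⇔ =
      (λ I θ₁ θ₂ inAᵢ → from (A⇔ _ _)
         (compatible-joinClosed φ I θ₁ θ₂ (λ i → to (A⇔ _ _) (inAᵢ i))))
    , (λ θ₁ θ₂ α inA α⊆θ₁ → from (A⇔ _ _)
         (compatible-downClosed φ θ₁ θ₂ α (to (A⇔ _ _) inA) α⊆θ₁))
    , (φ , λ a _ θ₂ → A⇔ (principal0 M a) θ₂)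

  -- Under perfect extension, (1)–(3) force A to be the φ-compatible pairs of
  -- the φ in (3): both are determined by the principal congruences θ(0,a),
  -- a ∈ B(M), on which they agree by (3).
  conditions⇒described : PerfectExtensionOfB M → (A : ConSubset M D) → RespectsEq M D A →
                         JoinClosed M D A → DownClosed₁ M D A → Condition3 M D A →
                         Σ[ φ ∈ BoundedLatHom MLat D ] DescribedBy φ A
  conditions⇒described PE A respects joinClosed downClosed (φ , onPrincipals) =
    φ , λ θ₁ θ₂ → mk⇔ (A⇒compatible θ₁ θ₂) (compatible⇒A θ₁ θ₂)
    where
    A⇒compatible : ∀ θ₁ θ₂ → A θ₁ θ₂ → Compatible φ θ₁ θ₂
    A⇒compatible θ₁ θ₂ inA =
      compatible-intro φ θ₁ θ₂ (λ r → principals⊆φ⁻¹θ₂ (proj₁ (join-of-principals PE θ₁) r))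
      where
      principals⊆φ⁻¹θ₂ : DMCong.rel (principalsBelow θ₁) ⊆ LatCong.rel (preimage φ θ₂)
      principals⊆φ⁻¹θ₂ = ⋁M-below (principal0 M ∘ proj₁) (preimage φ θ₂)
        λ { (a , a∈B , below) → compatible-elim φ (principal0 M a) θ₂
              (to (onPrincipals a a∈B θ₂) (downClosed θ₁ θ₂ (principal0 M a) inA below)) }
    compatible⇒A : ∀ θ₁ θ₂ → Compatible φ θ₁ θ₂ → A θ₁ θ₂
    compatible⇒A θ₁ θ₂ compatible =
      respects (principalsBelow θ₁) θ₁ (⋁L (λ _ → θ₂)) θ₂
        (proj₂ (join-of-principals PE θ₁) , proj₁ (join-of-principals PE θ₁))
        (⋁L-const (zero-below θ₁) θ₂)
        (joinClosed (PrincipalBelow θ₁) (principal0 M ∘ proj₁) (λ _ → θ₂)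
          λ { (a , a∈B , below) → from (onPrincipals a a∈B θ₂)
                (compatible-downClosed φ θ₁ θ₂ (principal0 M a) compatible below) })

  -- Construction: from a (0,1)-homomorphism φ : M → D, the principal
  -- MS-algebra L = {(a, x) ∈ M × D | x ≤ φ a} with componentwise lattice
  -- operations, (a, x)° = (a°, φ(a°)) and d_L = (1, 0).  Here
  -- L°° = {(a, φ a)} ≅ M, D(L) = {(1, x)} ≅ D, and (a, φ a) ∨ d_L = (1, φ a).
  module Construction (φ : BoundedLatHom MLat D) where
    private
      module F = BoundedLatHom φ
      module DL = LatticeLaws D

    Pair : Set
    Pair = Σ[ a ∈ M.Carrier ] Σ[ x ∈ D.Carrier ] x D.≤ F.fun a

    -- pairs are equal when their components are (the order proof is unique)
    pair-≡ : ∀ {a b x y} {x≤ : x D.≤ F.fun a} {y≤ : y D.≤ F.fun b} →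
             a ≡ b → x ≡ y → _≡_ {A = Pair} (a , x , x≤) (b , y , y≤)
    pair-≡ {x≤ = x≤} {y≤} refl refl = cong (λ p → (_ , _ , p)) (uip x≤ y≤)

    _∨ᴾ_ : Pair → Pair → Pair
    (a , x , x≤) ∨ᴾ (b , y , y≤) = a M.∨ b , x D.∨ y ,
      subst ((x D.∨ y) D.≤_) (sym (F.∨-hom a b)) (DL.∨-mono-≤ x≤ y≤)

    _∧ᴾ_ : Pair → Pair → Pair
    (a , x , x≤) ∧ᴾ (b , y , y≤) = a M.∧ b , x D.∧ y ,
      subst ((x D.∧ y) D.≤_) (sym (F.∧-hom a b)) (DL.∧-mono-≤ x≤ y≤)

    _°ᴾ : Pair → Pair
    (a , _ , _) °ᴾ = a M.° , F.fun (a M.°) , DL.∧-idem _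

    0ᴾ 1ᴾ dᴾ : Pair
    0ᴾ = M.0# , D.0# , DL.∧-zeroˡ _
    1ᴾ = M.1# , D.1# , trans (D.1-greatest _) F.1-hom
    dᴾ = M.1# , D.0# , DL.∧-zeroˡ _

    isDistributiveLatticeᴾ : LS.IsDistributiveLattice _≡_ _∨ᴾ_ _∧ᴾ_
    isDistributiveLatticeᴾ = record
      { isLattice = record
        { isEquivalence = isEquivalence
        ; ∨-comm = λ { (a , x , _) (b , y , _) → pair-≡ (M.∨-comm a b) (DL.∨-comm x y) }
        ; ∨-assoc = λ { (a , x , _) (b , y , _) (c , z , _) →
            pair-≡ (M.∨-assoc a b c) (DL.∨-assoc x y z) }
        ; ∨-cong = cong₂ _∨ᴾ_
        ; ∧-comm = λ { (a , x , _) (b , y , _) → pair-≡ (M.∧-comm a b) (DL.∧-comm x y) }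
        ; ∧-assoc = λ { (a , x , _) (b , y , _) (c , z , _) →
            pair-≡ (M.∧-assoc a b c) (DL.∧-assoc x y z) }
        ; ∧-cong = cong₂ _∧ᴾ_
        ; absorptive =
            (λ { (a , x , _) (b , y , _) → pair-≡ (M.∨-absorbs-∧ a b) (DL.∨-absorbs-∧ x y) }) ,
            (λ { (a , x , _) (b , y , _) → pair-≡ (M.∧-absorbs-∨ a b) (DL.∧-absorbs-∨ x y) })
        }
      ; ∨-distrib-∧ =
          (λ { (a , x , _) (b , y , _) (c , z , _) →
             pair-≡ (M.∨-distribˡ-∧ a b c) (DL.∨-distribˡ-∧ x y z) }) ,
          (λ { (a , x , _) (b , y , _) (c , z , _) →
             pair-≡ (M.∨-distribʳ-∧ a b c) (DL.∨-distribʳ-∧ x y z) })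
      ; ∧-distrib-∨ =
          (λ { (a , x , _) (b , y , _) (c , z , _) →
             pair-≡ (M.∧-distribˡ-∨ a b c) (DL.∧-distribˡ-∨ x y z) }) ,
          (λ { (a , x , _) (b , y , _) (c , z , _) →
             pair-≡ (M.∧-distribʳ-∨ a b c) (DL.∧-distribʳ-∨ x y z) })
      }

    msAlgebraᴾ : MSAlgebra
    msAlgebraᴾ = record
      { lattice = record
          { Carrier = Pair ; _∨_ = _∨ᴾ_ ; _∧_ = _∧ᴾ_ ; 0# = 0ᴾ ; 1# = 1ᴾ
          ; isDistributiveLattice = isDistributiveLatticeᴾ
          ; 0-least = λ { (a , x , _) → pair-≡ (M.0-least a) (D.0-least x) }
          ; 1-greatest = λ { (a , x , _) → pair-≡ (M.1-greatest a) (D.1-greatest x) } }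
      ; _° = _°ᴾ
      ; ≤-°° = λ { (a , x , x≤) → pair-≡ (trans (cong (a M.∧_) (M.°° a)) (M.∧-idem a))
                                         (trans (cong (λ t → x D.∧ F.fun t) (M.°° a)) x≤) }
      ; °-∧ = λ { (a , _ , _) (b , _ , _) →
          pair-≡ (M.°-∧ a b) (trans (cong F.fun (M.°-∧ a b)) (F.∨-hom _ _)) }
      ; 1° = pair-≡ M.1° (trans (cong F.fun M.1°) F.0-hom) }

    -- (a, x)° = 0 iff a = 1 iff d_L ≤ (a, x)
    D-charᴾ : ∀ p → (p °ᴾ ≡ 0ᴾ) ⇔ (dᴾ ∧ᴾ p ≡ dᴾ)
    D-charᴾ (a , x , _) = mk⇔
      (λ p°≡0 → pair-≡ (trans (M.1-greatest a) (M.°≡0⇒≡1 a (cong proj₁ p°≡0))) (DL.∧-zeroˡ x))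
      (λ d≤p → let a≡1 = trans (sym (M.1-greatest a)) (cong proj₁ d≤p) in
        pair-≡ (trans (cong M._° a≡1) M.1°)
               (trans (cong (F.fun ∘ M._°) a≡1) (trans (cong F.fun M.1°) F.0-hom)))

    L : PrincipalMS
    L = record
      { msAlgebra = msAlgebraᴾ
      ; d = dᴾ
      ; D-char = D-charᴾ
      ; decomp = λ { (a , x , x≤) → pair-≡
          (sym (trans (cong₂ M._∧_ (M.°° a) (M.∨-zeroʳ a)) (M.∧-identityʳ a)))
          (sym (trans (cong₂ D._∧_ (cong F.fun (M.°° a)) (DL.∨-identityʳ x))
                      (trans (DL.∧-comm _ x) x≤))) } }

    τ₁ : IsoToL°° M L
    τ₁ = record
      { fun = λ a → a , F.fun a , DL.∧-idem _
      ; into = λ a → pair-≡ (sym (M.°° a)) (cong F.fun (sym (M.°° a)))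
      ; ∨-hom = λ a b → pair-≡ refl (F.∨-hom a b)
      ; ∧-hom = λ a b → pair-≡ refl (F.∧-hom a b)
      ; °-hom = λ a → refl
      ; 0-hom = pair-≡ refl F.0-hom
      ; 1-hom = pair-≡ refl F.1-hom
      ; injective = λ a b → cong proj₁
      ; onto = λ { (a , x , _) p≡p°° →
          a , pair-≡ refl (sym (trans (cong (proj₁ ∘ proj₂) p≡p°°) (cong F.fun (M.°° a)))) } }

    τ₂ : IsoToD D L
    τ₂ = record
      { fun = λ x → M.1# , x , trans (cong (x D.∧_) F.1-hom) (DL.∧-identityʳ x)
      ; into = λ x → pair-≡ M.1° (trans (cong F.fun M.1°) F.0-hom)
      ; ∨-hom = λ x y → pair-≡ (sym (M.∨-idem _)) refl
      ; ∧-hom = λ x y → pair-≡ (sym (M.∧-idem _)) refl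
      ; 0-hom = pair-≡ refl refl
      ; 1-hom = pair-≡ refl refl
      ; injective = λ x y → cong (proj₁ ∘ proj₂)
      ; onto = λ { (a , x , _) p°≡0 → x , pair-≡ (sym (M.°≡0⇒≡1 a (cong proj₁ p°≡0))) refl } }

    φ-spec : ∀ a → IsoToD.fun τ₂ (F.fun a) ≡ PrincipalMS._∨_ L (IsoToL°°.fun τ₁ a) dᴾ
    φ-spec a = pair-≡ (sym (M.∨-zeroʳ a)) (sym (DL.∨-identityʳ (F.fun a)))

  described⇒representable : (A : ConSubset M D) (φ : BoundedLatHom MLat D) → DescribedBy φ A →
                            Representable M D A
  described⇒representable A φ A⇔ =
    L , τ₁ , τ₂ , λ θ₁ θ₂ → ⇔-sym (inA⇔compatible θ₁ θ₂) ⇔-∘ A⇔ θ₁ θ₂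
    where
    open Construction φ
    open PairCorrespondence L τ₁ τ₂ φ φ-spec

-- Both directions pass through "A is the set of φ-compatible pairs".
corollary4p8 : (M : DeMorganAlgebra) → PerfectExtensionOfB M →
    (D : BDLattice) → (A : ConSubset M D) → RespectsEq M D A →
    IsSublattice M D A →
    (Representable M D A ⇔ (JoinClosed M D A × DownClosed₁ M D A × Condition3 M D A))
corollary4p8 M PE D A respects _ = mk⇔ necessity sufficiency
  where
  necessity : Representable M D A → JoinClosed M D A × DownClosed₁ M D A × Condition3 M D A
  necessity representable =
    let (φ , A⇔) = representation⇒described M D A representable
    in described⇒conditions M D A φ A⇔
  sufficiency : JoinClosed M D A × DownClosed₁ M D A × Condition3 M D A → Representable M D A
  sufficiency (joinClosed , downClosed , condition3) =
    let (φ , A⇔) = conditions⇒described M D PE A respects joinClosed downClosed condition3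
    in described⇒representable M D A φ A⇔
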